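{- Let $G$ be a graph with a coloring $\chi:V(G)\to[k]$. Let $\mathcal{F}_1$ be a $p_1$-family, $\mathcal{F}_2$ a $p_2$-family, and $\vec q=(q_1,\dots,q_k)$ a vector with $\mathrm{sm}(\vec q)+p_1+p_2\le 2^{k-1}$. Let $\mathcal{F}'_1\subseteq\mathcal{F}_1$ be a $p_1$-family such that $\mathcal{F}'_1$ $\vec{q_1}$-Grundy represents $\mathcal{F}_1$ for every vector $\vec{q_1}\ge\vec q$ with $\mathrm{sm}(\vec{q_1})\le\mathrm{sm}(\vec q)+p_2$, and let $\mathcal{F}'_2\subseteq\mathcal{F}_2$ be a $p_2$-family such that $\mathcal{F}'_2$ $\vec{q_2}$-Grundy represents $\mathcal{F}_2$ for every vector $\vec{q_2}\ge\vec q$ with $\mathrm{sm}(\vec{q_2})\le\mathrm{sm}(\vec q)+p_1$. Then $\mathcal{F}'_1\star\mathcal{F}'_2$ $\vec q$-Grundy represents $\mathcal{F}_1\star\mathcal{F}_2$.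
   Context: Let $X_z=\chi^{ -1}(z)$ for $z\in[k]$. A set $A\subseteq V(G)$ is $\chi$-independent if $A\cap X_z$ is an independent set of $G$ for every $z\in[k]$. For $p\in\mathbb{N}$, a $p$-family is a family of $\chi$-independent subsets of $V(G)$, each of size at most $p$. Vectors have $k$ entries in $\mathbb{N}=\{0,1,2,\dots\}$; $\mathrm{sm}(\vec q)=\sum_{z\in[k]}q_z$; $\vec a\ge\vec b$ means $a_z\ge b_z$ for all $z$. A set $B\subseteq V(G)$ has size $\vec q$ if $|B\cap X_z|=q_z$ for all $z\in[k]$. A set $A$ fits $B$ if $A\cup B$ is $\chi$-independent. For a $p$-family $\mathcal{F}$ and $\mathcal{F}'\subseteq\mathcal{F}$, $\mathcal{F}'$ $\vec q$-Grundy represents $\mathcal{F}$ if for every $B\subseteq V(G)$ of size $\vec q$, whenever some $A\in\mathcal{F}$ fits $B$, some $A'\in\mathcal{F}'$ fits $B$. For families $\mathcal{F}_1,\mathcal{F}_2$, $\mathcal{F}_1\star\mathcal{F}_2=\{A_1\cup A_2: A_1\in\mathcal{F}_1,A_2\in\mathcal{F}_2, A_1\cup A_2\text{ is }\chi\text{ -independent}\}$. -}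

module Defs where

open import Level using (0ℓ)
open import Data.Nat using (ℕ; _≤_; _+_)
open import Data.Fin using (Fin; _≟_)
open import Data.Fin.Subset using (Subset; _∈_; _∩_; _∪_; ∣_∣)
open import Data.Vec using (tabulate; sum)
open import Data.Product using (Σ; _×_; ∃; ∃-syntax)
open import Relation.Nullary using (¬_; does)
open import Relation.Binary.PropositionalEquality using (_≡_)

record Graph (n : ℕ) : Set₁ where
  field
    Adj   : Fin n → Fin n → Set
    sym   : ∀ {u v} → Adj u v → Adj v u
    irrefl : ∀ {v} → ¬ Adj v v

module _ {n k : ℕ} (G : Graph n) (χ : Fin n → Fin k) where
  open Graph G

  X : Fin k → Subset n
  X z = tabulate (λ v → does (χ v ≟ z))

  Independent : Subset n → Set
  Independent S = ∀ u v → u ∈ S → v ∈ S → ¬ Adj u v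

  χIndependent : Subset n → Set
  χIndependent A = ∀ z → Independent (A ∩ X z)

  Family : Set₁
  Family = Subset n → Set

  _⊆F_ : Family → Family → Set
  F' ⊆F F = ∀ A → F' A → F A

  IsPFamily : ℕ → Family → Set
  IsPFamily p F = ∀ A → F A → χIndependent A × ∣ A ∣ ≤ p

  HasSize : (Fin k → ℕ) → Subset n → Set
  HasSize q B = ∀ z → ∣ B ∩ X z ∣ ≡ q z

  Fits : Subset n → Subset n → Set
  Fits A B = χIndependent (A ∪ B)

  GrundyRepresents : (Fin k → ℕ) → Family → Family → Set
  GrundyRepresents q F' F =
    ∀ B → HasSize q B → (∃[ A ] (F A × Fits A B)) → ∃[ A' ] (F' A' × Fits A' B)

  _⋆_ : Family → Family → Family
  (F₁ ⋆ F₂) C = ∃[ A₁ ] ∃[ A₂ ] (F₁ A₁ × F₂ A₂ × C ≡ A₁ ∪ A₂ × χIndependent C)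

sm : {k : ℕ} → (Fin k → ℕ) → ℕ
sm q = sum (tabulate q)

_≥ᵛ_ : {k : ℕ} → (Fin k → ℕ) → (Fin k → ℕ) → Set
a ≥ᵛ b = ∀ z → b z ≤ a z

-- If A₁ ∪ A₂ fits B with Aᵢ ∈ Fᵢ, then A₁ fits B ∪ A₂, a set whose size vector
-- dominates q and sums to at most sm q + p₂; so some A₁' ∈ F₁' fits B ∪ A₂.
-- Then A₂ fits B ∪ A₁', and the same argument yields A₂' ∈ F₂' fitting B ∪ A₁'.
-- Hence A₁' ∪ A₂' fits B, and it belongs to F₁' ⋆ F₂'.
module Submission where

open import Defs
open import Data.Nat using (ℕ; _≤_; _+_; _^_; _∸_)
open import Data.Fin using (Fin)

open import Algebra.Bundles using (CommutativeMonoid)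
open import Data.Bool using (Bool; true; false)
open import Data.Fin using (zero; suc; _≟_)
open import Data.Fin.Subset using (Subset; _∩_; _∪_; _⊆_; ∣_∣)
open import Data.Fin.Subset.Properties
  using (∣p∣≤∣x∷p∣; ∣p∣≤∣p∪q∣; p⊆p∪q; x∈p∩q⁺; x∈p∩q⁻; ∩-distribʳ-∪; ∪-commutativeMonoid)
open import Data.Nat using (zero; suc; z≤n; s≤s)
open import Data.Nat.Properties
  using (≤-trans; ≤-reflexive; +-mono-≤; +-monoʳ-≤; +-suc; +-commutativeSemigroup; module ≤-Reasoning)
open import Data.Product using (_,_; ∃-syntax; _×_; proj₂; map₁)
open import Data.Vec using ([]; _∷_; tabulate; sum)
open import Data.Vec.Properties using (tabulate-cong)
open import Function using (_∘_)
open import Relation.Nullary using (does)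
open import Relation.Binary.PropositionalEquality
  using (_≡_; refl; sym; trans; cong; cong₂; subst; module ≡-Reasoning)

open import Algebra.Properties.CommutativeSemigroup +-commutativeSemigroup using (interchange)

𝟙 : Bool → ℕ
𝟙 true  = 1
𝟙 false = 0

∣x∷p∣≡𝟙x+∣p∣ : ∀ {n} (x : Bool) (p : Subset n) → ∣ x ∷ p ∣ ≡ 𝟙 x + ∣ p ∣
∣x∷p∣≡𝟙x+∣p∣ true  p = refl
∣x∷p∣≡𝟙x+∣p∣ false p = refl

∣p∪q∣≤∣p∣+∣q∣ : ∀ {n} (p q : Subset n) → ∣ p ∪ q ∣ ≤ ∣ p ∣ + ∣ q ∣
∣p∪q∣≤∣p∣+∣q∣ []          []      = z≤n
∣p∪q∣≤∣p∣+∣q∣ (true ∷ p)  (y ∷ q) = s≤s (≤-trans (∣p∪q∣≤∣p∣+∣q∣ p q) (+-monoʳ-≤ ∣ p ∣ (∣p∣≤∣x∷p∣ y q)))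
∣p∪q∣≤∣p∣+∣q∣ (false ∷ p) (true ∷ q) =
  ≤-trans (s≤s (∣p∪q∣≤∣p∣+∣q∣ p q)) (≤-reflexive (sym (+-suc ∣ p ∣ ∣ q ∣)))
∣p∪q∣≤∣p∣+∣q∣ (false ∷ p) (false ∷ q) = ∣p∪q∣≤∣p∣+∣q∣ p q

sm-cong : ∀ {k} {f g : Fin k → ℕ} → (∀ z → f z ≡ g z) → sm f ≡ sm g
sm-cong = cong sum ∘ tabulate-cong

sm-mono : ∀ {k} {f g : Fin k → ℕ} → (∀ z → f z ≤ g z) → sm f ≤ sm g
sm-mono {zero}  f≤g = z≤n
sm-mono {suc k} f≤g = +-mono-≤ (f≤g zero) (sm-mono (f≤g ∘ suc))

sm-distrib-+ : ∀ {k} (f g : Fin k → ℕ) → sm (λ z → f z + g z) ≡ sm f + sm g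
sm-distrib-+ {zero}  f g = refl
sm-distrib-+ {suc k} f g =
  trans (cong (f zero + g zero +_) (sm-distrib-+ (f ∘ suc) (g ∘ suc)))
        (interchange (f zero) (g zero) (sm (f ∘ suc)) (sm (g ∘ suc)))

sm-zero : ∀ {k} → sm {k} (λ _ → 0) ≡ 0
sm-zero {zero}  = refl
sm-zero {suc k} = sm-zero {k}

sm-δ : ∀ {k} (c : Fin k) → sm (λ z → 𝟙 (does (c ≟ z))) ≡ 1
sm-δ {suc k} zero    = cong suc (sm-zero {k})
sm-δ         (suc c) = sm-δ c

-- Defs.X G χ z unfolds to fibre χ z; unlike X, the fibre does not mention the
-- graph, so it can be restricted along suc in an induction on the vertex set.
fibre : ∀ {n k} → (Fin n → Fin k) → Fin k → Subset n
fibre χ z = tabulate (λ v → does (χ v ≟ z))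

sm-∣∩fibre∣ : ∀ {n k} (χ : Fin n → Fin k) (C : Subset n) →
  sm (λ z → ∣ C ∩ fibre χ z ∣) ≡ ∣ C ∣
sm-∣∩fibre∣ {k = k} χ [] = sm-zero {k}
sm-∣∩fibre∣ χ (false ∷ C) = sm-∣∩fibre∣ (χ ∘ suc) C
sm-∣∩fibre∣ χ (true ∷ C) = begin
  sm (λ z → ∣ does (χ zero ≟ z) ∷ (C ∩ fibre (χ ∘ suc) z) ∣)
    ≡⟨ sm-cong (λ z → ∣x∷p∣≡𝟙x+∣p∣ (does (χ zero ≟ z)) (C ∩ fibre (χ ∘ suc) z)) ⟩
  sm (λ z → 𝟙 (does (χ zero ≟ z)) + ∣ C ∩ fibre (χ ∘ suc) z ∣)
    ≡⟨ sm-distrib-+ (λ z → 𝟙 (does (χ zero ≟ z))) (λ z → ∣ C ∩ fibre (χ ∘ suc) z ∣) ⟩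
  sm (λ z → 𝟙 (does (χ zero ≟ z))) + sm (λ z → ∣ C ∩ fibre (χ ∘ suc) z ∣)
    ≡⟨ cong₂ _+_ (sm-δ (χ zero)) (sm-∣∩fibre∣ (χ ∘ suc) C) ⟩
  suc ∣ C ∣ ∎
  where open ≡-Reasoning

module _ {n k : ℕ} (G : Graph n) (χ : Fin n → Fin k) where

  open import Algebra.Properties.CommutativeSemigroup
    (CommutativeMonoid.commutativeSemigroup (∪-commutativeMonoid n))
    using (xy∙z≈x∙zy; x∙yz≈z∙yx)

  sizeOf : Subset n → Fin k → ℕ
  sizeOf C z = ∣ C ∩ X G χ z ∣

  sizeOf-∪ : ∀ (B A : Subset n) z → sizeOf (B ∪ A) z ≤ sizeOf B z + sizeOf A z
  sizeOf-∪ B A z =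
    subst (_≤ sizeOf B z + sizeOf A z) (cong ∣_∣ (sym (∩-distribʳ-∪ (X G χ z) B A)))
          (∣p∪q∣≤∣p∣+∣q∣ (B ∩ X G χ z) (A ∩ X G χ z))

  sizeOf-∪-≥ : ∀ {q} (B A : Subset n) → HasSize G χ q B → sizeOf (B ∪ A) ≥ᵛ q
  sizeOf-∪-≥ {q} B A hB z = begin
    q z                                 ≡⟨ sym (hB z) ⟩
    ∣ B ∩ X G χ z ∣                     ≤⟨ ∣p∣≤∣p∪q∣ (B ∩ X G χ z) (A ∩ X G χ z) ⟩
    ∣ (B ∩ X G χ z) ∪ (A ∩ X G χ z) ∣   ≡⟨ cong ∣_∣ (sym (∩-distribʳ-∪ (X G χ z) B A)) ⟩
    ∣ (B ∪ A) ∩ X G χ z ∣               ∎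
    where open ≤-Reasoning

  sm-sizeOf-∪-≤ : ∀ {q} (B A : Subset n) → HasSize G χ q B → sm (sizeOf (B ∪ A)) ≤ sm q + ∣ A ∣
  sm-sizeOf-∪-≤ {q} B A hB = begin
    sm (sizeOf (B ∪ A))                     ≤⟨ sm-mono (sizeOf-∪ B A) ⟩
    sm (λ z → sizeOf B z + sizeOf A z)      ≡⟨ sm-distrib-+ (sizeOf B) (sizeOf A) ⟩
    sm (sizeOf B) + sm (sizeOf A)           ≡⟨ cong₂ _+_ (sm-cong hB) (sm-∣∩fibre∣ χ A) ⟩
    sm q + ∣ A ∣                            ∎
    where open ≤-Reasoning

  χIndependent-⊆ : ∀ {C D} → C ⊆ D → χIndependent G χ D → χIndependent G χ C
  χIndependent-⊆ {C} C⊆D indD z u v u∈C∩Xz v∈C∩Xz =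
    indD z u v (restrict u∈C∩Xz) (restrict v∈C∩Xz)
    where
    restrict : C ∩ X G χ z ⊆ _ ∩ X G χ z
    restrict = x∈p∩q⁺ ∘ map₁ C⊆D ∘ x∈p∩q⁻ C (X G χ z)

  Fits⇒χIndependent : ∀ {A B} → Fits G χ A B → χIndependent G χ A
  Fits⇒χIndependent {B = B} = χIndependent-⊆ (p⊆p∪q B)

  Fits-∪⁻ : ∀ {A A' B} → Fits G χ (A ∪ A') B → Fits G χ A (B ∪ A')
  Fits-∪⁻ {A} {A'} {B} = subst (χIndependent G χ) (xy∙z≈x∙zy A A' B)

  Fits-∪⁺ : ∀ {A A' B} → Fits G χ A (B ∪ A') → Fits G χ (A ∪ A') B
  Fits-∪⁺ {A} {A'} {B} = subst (χIndependent G χ) (sym (xy∙z≈x∙zy A A' B))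

  Fits-swap : ∀ {A A' B} → Fits G χ A (B ∪ A') → Fits G χ A' (B ∪ A)
  Fits-swap {A} {A'} {B} = subst (χIndependent G χ) (x∙yz≈z∙yx A B A')

  GrundyRepresentsUpTo : ℕ → (Fin k → ℕ) → Family G χ → Family G χ → Set
  GrundyRepresentsUpTo p q F' F =
    (q' : Fin k → ℕ) → q' ≥ᵛ q → sm q' ≤ sm q + p → GrundyRepresents G χ q' F' F

  GrundyRepresentsUpTo-∪ : ∀ {p q F' F} (B A₀ : Subset n) →
    GrundyRepresentsUpTo p q F' F → HasSize G χ q B → ∣ A₀ ∣ ≤ p →
    ∃[ A ] (F A × Fits G χ A (B ∪ A₀)) → ∃[ A' ] (F' A' × Fits G χ A' (B ∪ A₀))
  GrundyRepresentsUpTo-∪ {p} {q} B A₀ rep hB ∣A₀∣≤p =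
    rep (sizeOf (B ∪ A₀)) (sizeOf-∪-≥ B A₀ hB)
        (≤-trans (sm-sizeOf-∪-≤ B A₀ hB) (+-monoʳ-≤ (sm q) ∣A₀∣≤p))
        (B ∪ A₀) (λ _ → refl)

lemma34 : {n k : ℕ} (G : Graph n) (χ : Fin n → Fin k)
    (p₁ p₂ : ℕ) (F₁ F₂ F₁' F₂' : Family G χ) (q : Fin k → ℕ) →
    IsPFamily G χ p₁ F₁ → IsPFamily G χ p₂ F₂ →
    sm q + p₁ + p₂ ≤ 2 ^ (k ∸ 1) →
    _⊆F_ G χ F₁' F₁ → IsPFamily G χ p₁ F₁' →
    ((q₁ : Fin k → ℕ) → q₁ ≥ᵛ q → sm q₁ ≤ sm q + p₂ → GrundyRepresents G χ q₁ F₁' F₁) →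
    _⊆F_ G χ F₂' F₂ → IsPFamily G χ p₂ F₂' →
    ((q₂ : Fin k → ℕ) → q₂ ≥ᵛ q → sm q₂ ≤ sm q + p₁ → GrundyRepresents G χ q₂ F₂' F₂) →
    GrundyRepresents G χ q (_⋆_ G χ F₁' F₂') (_⋆_ G χ F₁ F₂)
lemma34 G χ _ _ _ _ _ _ _ _ isF₂ _ _ isF₁' rep₁ _ _ rep₂
  B hB (_ , (A₁ , A₂ , A₁∈F₁ , A₂∈F₂ , refl , _) , A₁∪A₂-fits-B) =
  let (A₁' , A₁'∈F₁' , A₁'-fits-B∪A₂) =
        GrundyRepresentsUpTo-∪ G χ B A₂ rep₁ hB (proj₂ (isF₂ A₂ A₂∈F₂))
          (A₁ , A₁∈F₁ , Fits-∪⁻ G χ A₁∪A₂-fits-B)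
      (A₂' , A₂'∈F₂' , A₂'-fits-B∪A₁') =
        GrundyRepresentsUpTo-∪ G χ B A₁' rep₂ hB (proj₂ (isF₁' A₁' A₁'∈F₁'))
          (A₂ , A₂∈F₂ , Fits-swap G χ A₁'-fits-B∪A₂)
      A₁'∪A₂'-fits-B = Fits-∪⁺ G χ (Fits-swap G χ A₂'-fits-B∪A₁')
  in A₁' ∪ A₂' , (A₁' , A₂' , A₁'∈F₁' , A₂'∈F₂' , refl , Fits⇒χIndependent G χ A₁'∪A₂'-fits-B)
   , A₁'∪A₂'-fits-B
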